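{- Every graph $G$ with $\sigma(G) = k \ge 3$ satisfies $\chi(G) \le k + 2^{2^{k-1}-k-1}$. Thus $$k \ge \log_2\left(\log_2(\chi(G)-k) + k + 1\right).$$
   Context: $\chi(G)$ is the chromatic number of $G$. An orientation covering of $G$ is a set of orientations $\overrightarrow{G_1},\dots,\overrightarrow{G_k}$ of $G$ such that for every vertex $u$ and any two distinct neighbors $v,w$ of $u$, some $\overrightarrow{G_i}$ contains both arcs $\overrightarrow{uv}$ and $\overrightarrow{uw}$. $\sigma(G)$ is the minimum size of an orientation covering of $G$. -}

module Defs where

open import Data.Nat using (ℕ; _<_)
open import Data.Fin using (Fin)
open import Data.Bool using (Bool; true; false)
open import Data.Product using (Σ; _×_; ∃)
open import Data.Sum using (_⊎_)
open import Relation.Binary.PropositionalEquality using (_≡_; _≢_)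
open import Relation.Nullary using (¬_)

record Graph : Set where
  field
    n     : ℕ
    adj   : Fin n → Fin n → Bool
    sym   : ∀ u v → adj u v ≡ adj v u
    irrefl : ∀ u → adj u u ≡ false
open Graph public

Edge : (G : Graph) → Fin (n G) → Fin (n G) → Set
Edge G u v = adj G u v ≡ true

record Orientation (G : Graph) : Set where
  field
    arc      : Fin (n G) → Fin (n G) → Bool
    arc-edge : ∀ u v → arc u v ≡ true → Edge G u v
    total    : ∀ u v → Edge G u v → arc u v ≡ true ⊎ arc v u ≡ true
    antisym  : ∀ u v → arc u v ≡ true → arc v u ≡ false
open Orientation public

IsOrientationCovering : (G : Graph) (k : ℕ) → (Fin k → Orientation G) → Set
IsOrientationCovering G k O =
  ∀ u v w → Edge G u v → Edge G u w → v ≢ w →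
    ∃ λ (i : Fin k) → (arc (O i) u v ≡ true) × (arc (O i) u w ≡ true)

HasOrientationCovering : Graph → ℕ → Set
HasOrientationCovering G k = Σ (Fin k → Orientation G) (IsOrientationCovering G k)

IsSigma : Graph → ℕ → Set
IsSigma G k = HasOrientationCovering G k × (∀ j → j < k → ¬ HasOrientationCovering G j)

ProperColouring : (G : Graph) (c : ℕ) → Set
ProperColouring G c =
  Σ (Fin (n G) → Fin c) λ f → ∀ u v → Edge G u v → f u ≢ f v

IsChromaticNumber : Graph → ℕ → Set
IsChromaticNumber G c = ProperColouring G c × (∀ j → j < c → ¬ ProperColouring G j)

module Submission where

-- Fix an orientation covering O₀, …, O_{k-1} of G and colour G explicitly.
-- * A vertex u is centred at i if every edge at u leaves u in Oᵢ.  Adjacent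
--   vertices are never centred at the same i, so centred vertices get colour i < k.
-- * A leaf u has a neighbour v with v → u in every Oᵢ.  Then v is the only
--   neighbour of u and v is no leaf, so u gets whichever of 0, 1 differs from v.
-- * Any other vertex u gets colour k + code(u), where code(u) is the binary code
--   of the set of profiles B ∈ {0,1}^(k-1) (directions of an edge in O₁,…,O_{k-1})
--   realised by some arc u → y of O₀.  For an arc u → x of O₀ between two such
--   vertices, the profile of ux is realised at u but not at x, and it has at least
--   two and at most k-2 false entries.  Only 2^(k-1) - k - 1 profiles qualify, so
--   code(u) < 2^(2^(k-1)-k-1).

open import Defs hiding (sym)
open import Data.Nat using (ℕ; zero; suc; pred; _≤_; _<_; _+_; _*_; _∸_; _^_; z≤n; s≤s; _≤?_)
open import Data.Nat.Properties
open import Data.Nat.Tactic.RingSolver using (solve-∀)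
open import Data.Bool using (Bool; true; false)
open import Data.Bool.Properties using () renaming (_≟_ to _≟ᵇ_)
open import Data.Fin using (Fin; toℕ; fromℕ<)
open import Data.Fin.Properties using (any?; all?; toℕ<n; toℕ-injective; toℕ-fromℕ<)
  renaming (_≟_ to _≟ᶠ_)
open import Data.Vec using (Vec; []; _∷_; lookup; tabulate)
open import Data.Vec.Properties using (lookup∘tabulate; ≡-dec)
open import Data.List as List using (List; []; _∷_; _++_; length)
open import Data.List.Properties using (length-++; length-map)
open import Data.List.Membership.Propositional using (_∈_)
open import Data.List.Membership.Propositional.Properties using (∈-map⁺; ∈-++⁺ˡ; ∈-++⁺ʳ)
open import Data.List.Relation.Unary.Any using (here; there)
open import Data.Product using (∃; _×_; _,_; proj₁; proj₂)
open import Data.Sum using (inj₁; inj₂)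
open import Data.Empty using (⊥; ⊥-elim)
open import Function using (_∘_)
open import Relation.Nullary using (¬_; Dec; yes; no; does)
open import Relation.Nullary.Decidable using (dec-true; dec-false; _×-dec_; _→-dec_)
open import Relation.Binary.PropositionalEquality
  using (_≡_; _≢_; refl; sym; trans; cong; cong₂; subst; module ≡-Reasoning)

true≢false : ∀ {b} → b ≡ true → b ≡ false → ⊥
true≢false refl ()

-- Binary codes of subsets of a list

bit : Bool → ℕ
bit true  = 1
bit false = 0

code : {A : Set} → (A → Bool) → List A → ℕ
code p []       = 0
code p (x ∷ xs) = bit (p x) + 2 * code p xs

code< : {A : Set} (p : A → Bool) (xs : List A) → code p xs < 2 ^ length xs
code< p []       = s≤s z≤n
code< p (x ∷ xs) = begin-strict
    bit (p x) + 2 * code p xs  <⟨ +-monoˡ-< (2 * code p xs) (bit<2 (p x)) ⟩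
    2 + 2 * code p xs          ≡⟨ sym (*-suc 2 (code p xs)) ⟩
    2 * suc (code p xs)        ≤⟨ *-monoʳ-≤ 2 (code< p xs) ⟩
    2 * 2 ^ length xs          ∎
  where
  open ≤-Reasoning
  bit<2 : ∀ b → bit b < 2
  bit<2 true  = s≤s (s≤s z≤n)
  bit<2 false = s≤s z≤n

digits-injective : ∀ a b e f → bit a + 2 * e ≡ bit b + 2 * f → a ≡ b × e ≡ f
digits-injective true  true  e f eq = refl , *-cancelˡ-≡ e f 2 (suc-injective eq)
digits-injective false false e f eq = refl , *-cancelˡ-≡ e f 2 eq
digits-injective true  false e f eq = ⊥-elim (even≢odd f e (sym eq))
digits-injective false true  e f eq = ⊥-elim (even≢odd e f eq)

code-separates : {A : Set} (p q : A → Bool) {x : A} (xs : List A) →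
                 x ∈ xs → p x ≢ q x → code p xs ≢ code q xs
code-separates p q (y ∷ ys) (here refl) p≢q eq =
  p≢q (proj₁ (digits-injective (p y) (q y) (code p ys) (code q ys) eq))
code-separates p q (y ∷ ys) (there x∈ys) p≢q eq =
  code-separates p q ys x∈ys p≢q (proj₂ (digits-injective (p y) (q y) (code p ys) (code q ys) eq))

-- Boolean vectors counted by their number of false entries

#false : ∀ {m} → Vec Bool m → ℕ
#false []          = 0
#false (true ∷ w)  = #false w
#false (false ∷ w) = suc (#false w)

#false≤ : ∀ {m} (w : Vec Bool m) → #false w ≤ m
#false≤ []          = z≤n
#false≤ (true ∷ w)  = m≤n⇒m≤1+n (#false≤ w)
#false≤ (false ∷ w) = s≤s (#false≤ w)

#false≡0 : ∀ {m} (w : Vec Bool m) → #false w ≡ 0 → ∀ j → lookup w j ≡ true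
#false≡0 (true ∷ w)  none Fin.zero    = refl
#false≡0 (true ∷ w)  none (Fin.suc j) = #false≡0 w none j

#false≡length : ∀ {m} (w : Vec Bool m) → #false w ≡ m → ∀ j → lookup w j ≡ false
#false≡length (true ∷ w)  all j = ⊥-elim (<⇒≱ (≤-reflexive (sym all)) (#false≤ w))
#false≡length (false ∷ w) all Fin.zero    = refl
#false≡length (false ∷ w) all (Fin.suc j) = #false≡length w (suc-injective all) j

#false≡1 : ∀ {m} (w : Vec Bool m) → #false w ≡ 1 →
           ∃ λ j → lookup w j ≡ false × (∀ j′ → lookup w j′ ≡ false → j′ ≡ j)
#false≡1 (true ∷ w) one with #false≡1 w one
... | j , false-at-j , unique =
  Fin.suc j , false-at-j , λ { Fin.zero () ; (Fin.suc j′) f → cong Fin.suc (unique j′ f) }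
#false≡1 (false ∷ w) one =
  Fin.zero , refl ,
  λ { Fin.zero _ → refl
    ; (Fin.suc j′) f → ⊥-elim (true≢false (#false≡0 w (suc-injective one) j′) f) }

branch : ∀ {m} → List (Vec Bool m) → List (Vec Bool m) → List (Vec Bool (suc m))
branch xs ys = List.map (true ∷_) xs ++ List.map (false ∷_) ys

∈-branch-true : ∀ {m} {w : Vec Bool m} xs ys → w ∈ xs → (true ∷ w) ∈ branch xs ys
∈-branch-true xs ys w∈xs = ∈-++⁺ˡ (∈-map⁺ (true ∷_) w∈xs)

∈-branch-false : ∀ {m} {w : Vec Bool m} xs ys → w ∈ ys → (false ∷ w) ∈ branch xs ys
∈-branch-false xs ys w∈ys = ∈-++⁺ʳ (List.map (true ∷_) xs) (∈-map⁺ (false ∷_) w∈ys)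

branch-length : ∀ {m} (xs ys : List (Vec Bool m)) {dx dy : ℕ} →
                length xs + dx ≡ 2 ^ m → length ys + dy ≡ 2 ^ m →
                length (branch xs ys) + (dx + dy) ≡ 2 ^ suc m
branch-length {m} xs ys {dx} {dy} xs-size ys-size = begin
    length (branch xs ys) + (dx + dy)
      ≡⟨ cong (_+ (dx + dy)) branch-size ⟩
    (length xs + length ys) + (dx + dy)
      ≡⟨ regroup (length xs) (length ys) dx dy ⟩
    (length xs + dx) + (length ys + dy)
      ≡⟨ cong₂ _+_ xs-size ys-size ⟩
    2 ^ m + 2 ^ m
      ≡⟨ cong (2 ^ m +_) (sym (+-identityʳ (2 ^ m))) ⟩
    2 ^ suc m ∎
  where
  open ≡-Reasoning
  branch-size : length (branch xs ys) ≡ length xs + length ys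
  branch-size = trans (length-++ (List.map (true ∷_) xs))
                      (cong₂ _+_ (length-map (true ∷_) xs) (length-map (false ∷_) ys))
  regroup : ∀ a b c d → (a + b) + (c + d) ≡ (a + c) + (b + d)
  regroup = solve-∀

-- AtLeast l m lists the vectors of length m with at least l false entries.
AtLeast : ℕ → (m : ℕ) → List (Vec Bool m)
AtLeast l       (suc m) = branch (AtLeast l m) (AtLeast (pred l) m)
AtLeast zero    zero    = [] ∷ []
AtLeast (suc l) zero    = []

-- Mixed l m lists the vectors of length m with at least l false entries
-- and at least one true entry.
Mixed : ℕ → (m : ℕ) → List (Vec Bool m)
Mixed l zero    = []
Mixed l (suc m) = branch (AtLeast l m) (Mixed (pred l) m)

∈-AtLeast : ∀ {l m} (w : Vec Bool m) → l ≤ #false w → w ∈ AtLeast l m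
∈-AtLeast {zero}  []          _ = here refl
∈-AtLeast {l} {suc m} (true ∷ w)  l≤ = ∈-branch-true _ (AtLeast (pred l) m) (∈-AtLeast w l≤)
∈-AtLeast {l} {suc m} (false ∷ w) l≤ =
  ∈-branch-false (AtLeast l m) _ (∈-AtLeast w (pred-mono-≤ l≤))

∈-Mixed : ∀ {l m} (w : Vec Bool m) → l ≤ #false w → #false w < m → w ∈ Mixed l m
∈-Mixed {l} {suc m} (true ∷ w)  l≤ _ = ∈-branch-true _ (Mixed (pred l) m) (∈-AtLeast w l≤)
∈-Mixed {l} {suc m} (false ∷ w) l≤ (s≤s <m) =
  ∈-branch-false (AtLeast l m) _ (∈-Mixed w (pred-mono-≤ l≤) <m)

-- below l m counts the vectors of length m with fewer than l false entries,
-- i.e. Σ_{i<l} C(m,i), computed by Pascal's rule.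
below : ℕ → ℕ → ℕ
below l       (suc m) = below l m + below (pred l) m
below zero    zero    = 0
below (suc l) zero    = 1

AtLeast-length : ∀ l m → length (AtLeast l m) + below l m ≡ 2 ^ m
AtLeast-length zero    zero    = refl
AtLeast-length (suc l) zero    = refl
AtLeast-length l       (suc m) =
  branch-length (AtLeast l m) (AtLeast (pred l) m) (AtLeast-length l m) (AtLeast-length (pred l) m)

-- Besides the vectors counted by below, Mixed misses only the all-false vector.
Mixed-length : ∀ l m → l ≤ m → length (Mixed l m) + suc (below l m) ≡ 2 ^ m
Mixed-length zero zero    z≤n = refl
Mixed-length l    (suc m) l≤  = trans (cong (length (Mixed l (suc m)) +_) (sym (+-suc _ _)))
  (branch-length (AtLeast l m) (Mixed (pred l) m)
    (AtLeast-length l m) (Mixed-length (pred l) m (pred-mono-≤ l≤)))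

below-2 : ∀ m → below 2 m ≡ suc m
below-2 zero    = refl
below-2 (suc m) = trans (cong₂ _+_ (below-2 m) (below-1 m)) (+-comm (suc m) 1)
  where
  below-0 : ∀ m → below 0 m ≡ 0
  below-0 zero    = refl
  below-0 (suc m) = cong₂ _+_ (below-0 m) (below-0 m)
  below-1 : ∀ m → below 1 m ≡ 1
  below-1 zero    = refl
  below-1 (suc m) = cong₂ _+_ (below-1 m) (below-0 m)

-- The colouring induced by an orientation covering O of size suc m

module CoveringColouring (G : Graph) (m : ℕ) (O : Fin (suc m) → Orientation G)
                         (covering : IsOrientationCovering G (suc m) O) where

  V : Set
  V = Fin (n G)

  k : ℕ
  k = suc m

  edge-sym : ∀ {u x} → Edge G u x → Edge G x u
  edge-sym {u} {x} e = trans (Graph.sym G x u) e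

  reverse-arc : ∀ {u x} i → Edge G u x → arc (O i) u x ≡ false → arc (O i) x u ≡ true
  reverse-arc {u} {x} i e no-arc with total (O i) u x e
  ... | inj₁ u→x = ⊥-elim (true≢false u→x no-arc)
  ... | inj₂ x→u = x→u

  no-two-way : ∀ {u x} i → arc (O i) u x ≡ true → arc (O i) x u ≡ true → ⊥
  no-two-way {u} {x} i u→x x→u = true≢false x→u (antisym (O i) u x u→x)

  Centred : V → Fin k → Set
  Centred u i = ∀ v → Edge G u v → arc (O i) u v ≡ true

  centred? : ∀ u → Dec (∃ (Centred u))
  centred? u = any? λ i → all? λ v → (adj G u v ≟ᵇ true) →-dec (arc (O i) u v ≟ᵇ true)

  centred-independent : ∀ {u x i} → Centred u i → Centred x i → Edge G u x → ⊥
  centred-independent {u} {x} {i} cu cx e = no-two-way i (cu x e) (cx u (edge-sym e))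

  -- An edge leaving u in exactly one Oᵢ forces u to be centred at i, since every
  -- other edge at u must leave u together with it in some orientation.
  centred-if-only : ∀ {u x} i → Edge G u x → arc (O i) u x ≡ true →
                    (∀ j → arc (O j) u x ≡ true → j ≡ i) → Centred u i
  centred-if-only {u} {x} i ex u→x only-i y ey with y ≟ᶠ x
  ... | yes refl = u→x
  ... | no y≢x with covering u x y ex ey (λ x≡y → y≢x (sym x≡y))
  ...   | j , u→ᵢx , u→ᵢy = subst (λ z → arc (O z) u y ≡ true) (only-i j u→ᵢx) u→ᵢy

  Leaf : V → Set
  Leaf u = ∃ λ v → Edge G u v × (∀ i → arc (O i) u v ≡ false)

  leaf? : ∀ u → Dec (Leaf u)
  leaf? u = any? λ v → (adj G u v ≟ᵇ true) ×-dec all? (λ i → arc (O i) u v ≟ᵇ false)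

  leaf-neighbour-unique : ∀ {u v x} → Edge G u v → (∀ i → arc (O i) u v ≡ false) →
                          Edge G u x → x ≡ v
  leaf-neighbour-unique {u} {v} {x} ev never ex with x ≟ᶠ v
  ... | yes x≡v = x≡v
  ... | no x≢v with covering u v x ev ex (λ v≡x → x≢v (sym v≡x))
  ...   | j , u→v , _ = ⊥-elim (true≢false u→v (never j))

  leaf-neighbour-not-leaf : ∀ {u v} → Edge G u v → (∀ i → arc (O i) u v ≡ false) → ¬ Leaf v
  leaf-neighbour-not-leaf {u} {v} ev never (w , ew , never′) with w ≟ᶠ u
  ... | yes refl = true≢false (reverse-arc Fin.zero ev (never Fin.zero)) (never′ Fin.zero)
  ... | no w≢u with covering v u w (edge-sym ev) ew (λ u≡w → w≢u (sym u≡w))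
  ...   | j , _ , v→w = true≢false v→w (never′ j)

  profile : V → V → Vec Bool m
  profile u v = tabulate (λ j → arc (O (Fin.suc j)) u v)

  lookup-profile : ∀ u v j → lookup (profile u v) j ≡ arc (O (Fin.suc j)) u v
  lookup-profile u v j = lookup∘tabulate (λ j → arc (O (Fin.suc j)) u v) j

  Realises : V → Vec Bool m → Set
  Realises u B = ∃ λ y → arc (O Fin.zero) u y ≡ true × profile u y ≡ B

  realised : V → Vec Bool m → Bool
  realised u B = does (any? λ y → (arc (O Fin.zero) u y ≟ᵇ true) ×-dec ≡-dec _≟ᵇ_ (profile u y) B)

  -- The profiles that can separate two adjacent vertices neither centred nor leaves.
  Profiles : List (Vec Bool m)
  Profiles = Mixed 2 m

  -- The profile of an arc u → x of O₀ is not realised at x: the covering would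
  -- give an orientation containing both x → y and x → u.
  not-realised-back : ∀ {u x} → Edge G u x → arc (O Fin.zero) u x ≡ true →
                      ¬ Realises x (profile u x)
  not-realised-back {u} {x} ex u→x (y , x→y , same) with y ≟ᶠ u
  ... | yes refl = no-two-way Fin.zero u→x x→y
  ... | no y≢u with covering x y u (arc-edge (O Fin.zero) x y x→y) (edge-sym ex) y≢u
  ...   | Fin.zero  , _ , x→u = no-two-way Fin.zero u→x x→u
  ...   | Fin.suc j , x→ⱼy , x→u = no-two-way (Fin.suc j) u→x′ x→u
    where
    u→x′ : arc (O (Fin.suc j)) u x ≡ true
    u→x′ = begin
      arc (O (Fin.suc j)) u x  ≡⟨ sym (lookup-profile u x j) ⟩
      lookup (profile u x) j   ≡⟨ cong (λ B → lookup B j) (sym same) ⟩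
      lookup (profile x y) j   ≡⟨ lookup-profile x y j ⟩
      arc (O (Fin.suc j)) x y  ≡⟨ x→ⱼy ⟩
      true ∎
      where open ≡-Reasoning

  profile-mixed : ∀ {u x} → Edge G u x → arc (O Fin.zero) u x ≡ true →
                  ¬ ∃ (Centred u) → ¬ ∃ (Centred x) → ¬ Leaf x → profile u x ∈ Profiles
  profile-mixed {u} {x} ex u→x u-free x-free x-not-leaf =
    ∈-Mixed B (two≤ (#false B) (x-leaf ∘ #false≡0 B) x-centred)
              (≤∧≢⇒< (#false≤ B) (u-centred ∘ #false≡length B))
    where
    B = profile u x
    two≤ : ∀ n → n ≢ 0 → n ≢ 1 → 2 ≤ n
    two≤ zero          n≢0 _   = ⊥-elim (n≢0 refl)
    two≤ (suc zero)    _   n≢1 = ⊥-elim (n≢1 refl)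
    two≤ (suc (suc n)) _   _   = s≤s (s≤s z≤n)
    -- all entries true: x → u in no orientation, so x is a leaf
    x-leaf : (∀ j → lookup B j ≡ true) → ⊥
    x-leaf all-true = x-not-leaf (u , edge-sym ex , λ i → antisym (O i) u x (u→ᵢx i))
      where
      u→ᵢx : ∀ i → arc (O i) u x ≡ true
      u→ᵢx Fin.zero    = u→x
      u→ᵢx (Fin.suc j) = trans (sym (lookup-profile u x j)) (all-true j)
    -- exactly one false entry j: x → u only in O_{j+1}, so x is centred there
    x-centred : #false B ≢ 1
    x-centred one with #false≡1 B one
    ... | j , false-at-j , unique = x-free (Fin.suc j ,
          centred-if-only (Fin.suc j) (edge-sym ex)
            (reverse-arc (Fin.suc j) ex (trans (sym (lookup-profile u x j)) false-at-j)) only)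
      where
      only : ∀ i → arc (O i) x u ≡ true → i ≡ Fin.suc j
      only Fin.zero     x→u = ⊥-elim (no-two-way Fin.zero u→x x→u)
      only (Fin.suc i′) x→u =
        cong Fin.suc (unique i′ (trans (lookup-profile u x i′) (antisym (O (Fin.suc i′)) x u x→u)))
    -- all entries false: u → x only in O₀, so u is centred at 0
    u-centred : (∀ j → lookup B j ≡ false) → ⊥
    u-centred all-false = u-free (Fin.zero , centred-if-only Fin.zero ex u→x only)
      where
      only : ∀ i → arc (O i) u x ≡ true → i ≡ Fin.zero
      only Fin.zero     _   = refl
      only (Fin.suc j) u→x′ = ⊥-elim (true≢false u→x′ (trans (sym (lookup-profile u x j)) (all-false j)))

  codes-differ : ∀ {u x} → Edge G u x → arc (O Fin.zero) u x ≡ true →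
                 ¬ ∃ (Centred u) → ¬ ∃ (Centred x) → ¬ Leaf x →
                 code (realised u) Profiles ≢ code (realised x) Profiles
  codes-differ {u} {x} ex u→x u-free x-free x-not-leaf =
    code-separates (realised u) (realised x) Profiles
      (profile-mixed ex u→x u-free x-free x-not-leaf)
      (λ same → true≢false (trans (sym same) at-u) at-x)
    where
    at-u : realised u (profile u x) ≡ true
    at-u = dec-true (any? _) (x , u→x , refl)
    at-x : realised x (profile u x) ≡ false
    at-x = dec-false (any? _) (not-realised-back ex u→x)

  inner-colour : (u : V) → Dec (∃ (Centred u)) → ℕ
  inner-colour u (yes (i , _)) = toℕ i
  inner-colour u (no _)        = k + code (realised u) Profiles

  inner : V → ℕ
  inner u = inner-colour u (centred? u)

  centre≢code : ∀ (i : Fin k) e → toℕ i ≢ k + e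
  centre≢code i e eq = <⇒≱ (toℕ<n i) (subst (k ≤_) (sym eq) (m≤m+n k e))

  inner-proper : ∀ u x (du : Dec (∃ (Centred u))) (dx : Dec (∃ (Centred x))) →
                 Edge G u x → ¬ Leaf u → ¬ Leaf x → inner-colour u du ≢ inner-colour x dx
  inner-proper u x (yes (i , cu)) (yes (j , cx)) e _ _ eq =
    centred-independent cu (subst (Centred x) (sym (toℕ-injective eq)) cx) e
  inner-proper u x (yes (i , _)) (no _) e _ _ eq = centre≢code i _ eq
  inner-proper u x (no _) (yes (j , _)) e _ _ eq = centre≢code j _ (sym eq)
  inner-proper u x (no u-free) (no x-free) e u-not-leaf x-not-leaf eq
    with arc (O Fin.zero) u x in u→x
  ... | true  = codes-differ e u→x u-free x-free x-not-leaf (+-cancelˡ-≡ k _ _ eq)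
  ... | false = codes-differ (edge-sym e) (reverse-arc Fin.zero e u→x) x-free u-free u-not-leaf
                  (+-cancelˡ-≡ k _ _ (sym eq))

  avoid : ℕ → ℕ
  avoid zero    = 1
  avoid (suc _) = 0

  avoid≢ : ∀ a → avoid a ≢ a
  avoid≢ zero    ()
  avoid≢ (suc a) ()

  leaf-colour : (u : V) → Dec (Leaf u) → ℕ
  leaf-colour u (yes (v , _)) = avoid (inner v)
  leaf-colour u (no _)        = inner u

  colour : V → ℕ
  colour u = leaf-colour u (leaf? u)

  colour-proper′ : ∀ u x (du : Dec (Leaf u)) (dx : Dec (Leaf x)) →
                   Edge G u x → leaf-colour u du ≢ leaf-colour x dx
  colour-proper′ u x (yes (v , ev , never)) dx e eq with leaf-neighbour-unique ev never e
  colour-proper′ u x (yes (v , ev , never)) (yes x-leaf) e eq | refl =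
    leaf-neighbour-not-leaf ev never x-leaf
  colour-proper′ u x (yes (v , ev , never)) (no _) e eq | refl = avoid≢ (inner x) eq
  colour-proper′ u x (no _) (yes (v , ev , never)) e eq with leaf-neighbour-unique ev never (edge-sym e)
  ... | refl = avoid≢ (inner u) (sym eq)
  colour-proper′ u x (no u-not-leaf) (no x-not-leaf) e eq =
    inner-proper u x (centred? u) (centred? x) e u-not-leaf x-not-leaf eq

  colour-proper : ∀ u x → Edge G u x → colour u ≢ colour x
  colour-proper u x = colour-proper′ u x (leaf? u) (leaf? x)

  inner-bound : ∀ u (du : Dec (∃ (Centred u))) → inner-colour u du < k + 2 ^ length Profiles
  inner-bound u (yes (i , _)) = ≤-trans (toℕ<n i) (m≤m+n k _)
  inner-bound u (no _)        = +-monoʳ-< k (code< (realised u) Profiles)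

  colour-bound : 1 ≤ m → ∀ u → colour u < k + 2 ^ length Profiles
  colour-bound 1≤m u = bound (leaf? u)
    where
    avoid<2 : ∀ a → avoid a < 2
    avoid<2 zero    = s≤s (s≤s z≤n)
    avoid<2 (suc _) = s≤s z≤n
    bound : (du : Dec (Leaf u)) → leaf-colour u du < k + 2 ^ length Profiles
    bound (yes (v , _)) = ≤-trans (avoid<2 (inner v)) (≤-trans (s≤s 1≤m) (m≤m+n k _))
    bound (no _)        = inner-bound u (centred? u)

proper-colouring : (G : Graph) (c : ℕ) (f : Fin (n G) → ℕ) → (∀ u → f u < c) →
                   (∀ u v → Edge G u v → f u ≢ f v) → ProperColouring G c
proper-colouring G c f f<c proper =
  (λ u → fromℕ< (f<c u)) ,
  λ u v e eq → proper u v e (begin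
    f u                   ≡⟨ sym (toℕ-fromℕ< (f<c u)) ⟩
    toℕ (fromℕ< (f<c u))  ≡⟨ cong toℕ eq ⟩
    toℕ (fromℕ< (f<c v))  ≡⟨ toℕ-fromℕ< (f<c v) ⟩
    f v ∎)
  where open ≡-Reasoning

χ≤ : ∀ {G c d} → IsChromaticNumber G c → ProperColouring G d → c ≤ d
χ≤ {c = c} {d} (_ , minimal) colouring with c ≤? d
... | yes c≤d = c≤d
... | no c≰d  = ⊥-elim (minimal d (≰⇒> c≰d) colouring)

-- Solving a + (b + 2) = c for a; used to compute the number 2^m - (m+1) - 1 of profiles.
exponent : ∀ {a b c} → a + suc (suc b) ≡ c → c ∸ suc b ∸ 1 ≡ a
exponent {a} {b} refl = begin
  a + suc (suc b) ∸ suc b ∸ 1  ≡⟨ cong (λ s → s ∸ suc b ∸ 1) (sym (+-assoc a 1 (suc b))) ⟩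
  a + 1 + suc b ∸ suc b ∸ 1    ≡⟨ cong (_∸ 1) (m+n∸n≡m (a + 1) (suc b)) ⟩
  a + 1 ∸ 1                    ≡⟨ m+n∸n≡m a 1 ⟩
  a ∎
  where open ≡-Reasoning

theorem13 : (G : Graph) (k : ℕ) → 3 ≤ k → IsSigma G k →
    (c : ℕ) → IsChromaticNumber G c → c ≤ k + 2 ^ (2 ^ (k ∸ 1) ∸ k ∸ 1)
theorem13 G _ (s≤s (s≤s (s≤s (z≤n {r})))) ((O , covering) , _) c χG =
  χ≤ {G} χG (subst (λ e → ProperColouring G (k + 2 ^ e)) (sym exponent≡) colouring)
  where
  m = suc (suc r)
  open CoveringColouring G m O covering
  profiles-size : length Profiles + suc (suc m) ≡ 2 ^ m
  profiles-size = trans (cong (λ d → length Profiles + suc d) (sym (below-2 m)))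
                        (Mixed-length 2 m (s≤s (s≤s z≤n)))
  exponent≡ : 2 ^ m ∸ suc m ∸ 1 ≡ length Profiles
  exponent≡ = exponent profiles-size
  colouring : ProperColouring G (k + 2 ^ length Profiles)
  colouring = proper-colouring G _ colour (colour-bound (s≤s z≤n)) colour-proper
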